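{- Let $n\ge 5$ be odd and let $G_n$ be the graph with vertex set $\{v_0,\dots,v_{n-1}\}$ whose edges are the pairs $\{v_i,v_{i+j}\}$ for $i=0,\dots,n-1$ and $j=1,\dots,\lfloor n/4\rfloor$, indices taken modulo $n$. Then for every vertex $v$ of $G_n$, the induced subgraph of $G_n$ obtained by removing $v$ is switching separable.
   Context: For a graph $G=(V,E)$ and $U\subseteq V$ (possibly empty or equal to $V$), the $U$-switching of $G$ is $G_U=(V,E\,\triangle\,E_{U,V\setminus U})$, where $E_{U,V\setminus U}$ is the edge set of the complete bipartite graph on $V$ with parts $U$ and $V\setminus U$. A set $W\subseteq V$ is isolable if $2\le|W|\le|V|-2$ and some switching $G_U$ contains no edge joining $W$ and $V\setminus W$. A graph is switching separable if its vertex set contains an isolable subset. -}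

module Defs where

open import Data.Nat using (ℕ; suc; _+_; _∸_; _≤_; _/_; _%_; NonZero)
open import Data.Fin using (Fin; toℕ; punchIn)
open import Data.Fin.Subset using (Subset; _∈_; _∉_; ∣_∣)
open import Data.Bool using (Bool; true; false; _xor_; T; _∧_; _∨_)
open import Data.Bool.Properties using (∨-comm)
open import Data.Nat using (_≤ᵇ_)
open import Data.Nat.Properties using (m+n∸m≡n)
open import Data.Nat.DivMod using (n%n≡0)
open import Data.Vec using (lookup)
open import Data.Product using (Σ; ∃; _×_)
open import Relation.Nullary using (¬_)
open import Relation.Binary.PropositionalEquality using (_≡_; refl; cong; trans)

record Graph (m : ℕ) : Set where
  field
    adj   : Fin m → Fin m → Bool
    sym   : ∀ x y → adj x y ≡ adj y x
    irrefl : ∀ x → adj x x ≡ false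

open Graph public

-- Adjacency of the U-switching G_U : an edge between x and y is toggled
-- exactly when one of them lies in U and the other does not
-- (E △ E_{U, V∖U}).
switchAdj : ∀ {m} → Graph m → Subset m → Fin m → Fin m → Bool
switchAdj G U x y = adj G x y xor (lookup U x xor lookup U y)

Isolable : ∀ {m} → Graph m → Subset m → Set
Isolable {m} G W =
  2 ≤ ∣ W ∣ × ∣ W ∣ ≤ m ∸ 2 ×
  Σ (Subset m) (λ U → ∀ x y → x ∈ W → y ∉ W → switchAdj G U x y ≡ false)

SwitchingSeparable : ∀ {m} → Graph m → Set
SwitchingSeparable {m} G = ∃ λ (W : Subset m) → Isolable G W

deleteVertex : ∀ {m} → Graph (suc m) → Fin (suc m) → Graph m
deleteVertex G v = record
  { adj = λ x y → adj G (punchIn v x) (punchIn v y)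
  ; sym = λ x y → sym G (punchIn v x) (punchIn v y)
  ; irrefl = λ x → irrefl G (punchIn v x) }

forwardDist : ∀ {p} → Fin (suc p) → Fin (suc p) → ℕ
forwardDist {p} i j = (toℕ j + suc p ∸ toℕ i) % suc p

stepEdge : ∀ {p} → Fin (suc p) → Fin (suc p) → Bool
stepEdge {p} i j = (1 ≤ᵇ forwardDist i j) ∧ (forwardDist i j ≤ᵇ (suc p / 4))

private
  forwardDist-self : ∀ {p} (i : Fin (suc p)) → forwardDist i i ≡ 0
  forwardDist-self {p} i = trans (cong (_% suc p) (m+n∸m≡n (toℕ i) (suc p))) (n%n≡0 (suc p))

  stepEdge-self : ∀ {p} (i : Fin (suc p)) → stepEdge i i ≡ false
  stepEdge-self i rewrite forwardDist-self i = refl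

circulantG : (p : ℕ) → Graph (suc p)
circulantG p = record
  { adj = λ i j → stepEdge i j ∨ stepEdge j i
  ; sym = λ i j → ∨-comm (stepEdge i j) (stepEdge j i)
  ; irrefl = λ i → irrefl′ i }
  where
  irrefl′ : (i : Fin (suc p)) → (stepEdge i i ∨ stepEdge i i) ≡ false
  irrefl′ i rewrite stepEdge-self i = refl

-- Write n = 2w + 1 and k = ⌊n/4⌋, so that m = w − k is k or k + 1, and put a = v + m, b = v − m.
-- The closed neighbourhoods of a and b in G_n are the arcs of 2k + 1 consecutive vertices centred
-- at them; these arcs meet only in v (if n = 4k + 1) or cover everything but v (if n = 4k + 3).
-- Hence every vertex of G_n − v other than a and b is adjacent to exactly one of them, and then
-- switching with respect to {a} ∪ N(b) leaves no edge between {a, b} and the remaining vertices.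

module Submission where

open import Defs hiding (sym)
open import Data.Nat using (ℕ; suc; _+_; _*_; _∸_; _≤_; _<_; _%_; _/_; _≤ᵇ_; NonZero; z≤n; s≤s; _≤?_)
open import Data.Nat.Properties hiding (_≟_)
open import Data.Nat.DivMod
open import Data.Nat.Tactic.RingSolver using (solve-∀)
open import Data.Fin using (Fin; zero; suc; toℕ; fromℕ<; punchIn; punchOut; _≟_)
open import Data.Fin.Properties using (toℕ<n; toℕ-fromℕ<; toℕ-injective; punchIn-punchOut; punchInᵢ≢i; punchIn-injective; punchOut-injective)
open import Data.Fin.Subset using (Subset; ⁅_⁆; _∪_; ∣_∣; _∈_; _∉_)
open import Data.Fin.Subset.Properties using (x∈p∪q⁻; x∈p∪q⁺; x∈⁅x⁆; x∈⁅y⁆⇒x≡y; ∣⁅x⁆∣≡1; ∪-identityˡ; ∪-identityʳ)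
open import Data.Vec using (lookup; tabulate)
open import Data.Vec.Properties using (lookup∘tabulate)
open import Data.Bool using (true; false; not; _∧_; _∨_; _xor_)
open import Data.Bool.Properties using (∧-zeroʳ; ∨-zeroʳ; not-distribʳ-xor; xor-same)
open import Data.Product using (∃; _×_; _,_)
open import Data.Sum using (_⊎_; inj₁; inj₂)
open import Function using (_∘_)
open import Relation.Binary.Definitions using (tri<; tri≈; tri>)
open import Relation.Nullary using (does; yes; no; contradiction)
open import Relation.Nullary.Decidable using (dec-true; dec-false)
open import Relation.Binary.PropositionalEquality

[m%n+o]%n≡[m+o]%n : ∀ m o n .{{_ : NonZero n}} → (m % n + o) % n ≡ (m + o) % n
[m%n+o]%n≡[m+o]%n m o n = begin
  (m % n + o) % n             ≡⟨ %-distribˡ-+ (m % n) o n ⟩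
  (m % n % n + o % n) % n     ≡⟨ cong (λ z → (z + o % n) % n) (m%n%n≡m%n m n) ⟩
  (m % n + o % n) % n         ≡⟨ %-distribˡ-+ m o n ⟨
  (m + o) % n                 ∎
  where open ≡-Reasoning

[m+n%o]%o≡[m+n]%o : ∀ m n o .{{_ : NonZero o}} → (m + n % o) % o ≡ (m + n) % o
[m+n%o]%o≡[m+n]%o m n o = begin
  (m + n % o) % o    ≡⟨ cong (_% o) (+-comm m (n % o)) ⟩
  (n % o + m) % o    ≡⟨ [m%n+o]%n≡[m+o]%n n m o ⟩
  (n + m) % o        ≡⟨ cong (_% o) (+-comm n m) ⟩
  (m + n) % o        ∎
  where open ≡-Reasoning

[m+n∸o]%n≡m∸o : ∀ {m n o} .{{_ : NonZero n}} → o ≤ m → m < n → (m + n ∸ o) % n ≡ m ∸ o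
[m+n∸o]%n≡m∸o {m} {n} {o} o≤m m<n = begin
  (m + n ∸ o) % n    ≡⟨ cong (_% n) (+-∸-comm n o≤m) ⟩
  (m ∸ o + n) % n    ≡⟨ [m+n]%n≡m%n (m ∸ o) n ⟩
  (m ∸ o) % n        ≡⟨ m<n⇒m%n≡m (≤-<-trans (m∸n≤m m o) m<n) ⟩
  m ∸ o              ∎
  where open ≡-Reasoning

[m+n∸o]%n≡m+n∸o : ∀ {m n o} .{{_ : NonZero n}} → m < o → (m + n ∸ o) % n ≡ m + n ∸ o
[m+n∸o]%n≡m+n∸o {m} {n} {o} m<o =
  m<n⇒m%n≡m (m<n+o⇒m∸n<o (m + n) o (+-monoˡ-< n m<o))

module _ {p : ℕ} where

  private
    n : ℕ
    n = suc p

  forwardDist<n : (x y : Fin n) → forwardDist x y < n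
  forwardDist<n x y = m%n<n (toℕ y + n ∸ toℕ x) n

  forwardDist-unique : ∀ {x y : Fin n} {t} → t < n → (toℕ x + t) % n ≡ toℕ y → forwardDist x y ≡ t
  forwardDist-unique {x} {y} {t} t<n x+t≡y = begin
    (toℕ y + n ∸ i) % n              ≡⟨ cong (λ z → (z + n ∸ i) % n) x+t≡y ⟨
    ((i + t) % n + n ∸ i) % n        ≡⟨ cong (_% n) (+-∸-assoc ((i + t) % n) (<⇒≤ (toℕ<n x))) ⟩
    ((i + t) % n + (n ∸ i)) % n      ≡⟨ [m%n+o]%n≡[m+o]%n (i + t) (n ∸ i) n ⟩
    (i + t + (n ∸ i)) % n            ≡⟨ cong (λ z → (z + (n ∸ i)) % n) (+-comm i t) ⟩
    (t + i + (n ∸ i)) % n            ≡⟨ cong (_% n) (+-assoc t i (n ∸ i)) ⟩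
    (t + (i + (n ∸ i))) % n          ≡⟨ cong (λ z → (t + z) % n) (m+[n∸m]≡n (<⇒≤ (toℕ<n x))) ⟩
    (t + n) % n                      ≡⟨ [m+n]%n≡m%n t n ⟩
    t % n                            ≡⟨ m<n⇒m%n≡m t<n ⟩
    t                                ∎
    where
    open ≡-Reasoning
    i = toℕ x

  forwardDist-correct : (c x : Fin n) → (toℕ c + forwardDist c x) % n ≡ toℕ x
  forwardDist-correct c x = begin
    (toℕ c + (toℕ x + n ∸ toℕ c) % n) % n   ≡⟨ [m+n%o]%o≡[m+n]%o (toℕ c) (toℕ x + n ∸ toℕ c) n ⟩
    (toℕ c + (toℕ x + n ∸ toℕ c)) % n       ≡⟨ cong (_% n) (m+[n∸m]≡n c≤x+n) ⟩
    (toℕ x + n) % n                         ≡⟨ [m+n]%n≡m%n (toℕ x) n ⟩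
    toℕ x % n                               ≡⟨ m<n⇒m%n≡m (toℕ<n x) ⟩
    toℕ x                                   ∎
    where
    open ≡-Reasoning
    c≤x+n : toℕ c ≤ toℕ x + n
    c≤x+n = ≤-trans (<⇒≤ (toℕ<n c)) (m≤n+m n (toℕ x))

  forwardDist-injective : ∀ (c : Fin n) {x y} → forwardDist c x ≡ forwardDist c y → x ≡ y
  forwardDist-injective c {x} {y} eq = toℕ-injective (begin
    toℕ x                            ≡⟨ forwardDist-correct c x ⟨
    (toℕ c + forwardDist c x) % n    ≡⟨ cong (λ z → (toℕ c + z) % n) eq ⟩
    (toℕ c + forwardDist c y) % n    ≡⟨ forwardDist-correct c y ⟩
    toℕ y                            ∎)
    where open ≡-Reasoning

  infixl 6 _⊕_
  _⊕_ : Fin n → ℕ → Fin n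
  c ⊕ s = fromℕ< (m%n<n (toℕ c + s) n)

  forwardDist-⊕ : ∀ (c : Fin n) {s} → s < n → forwardDist c (c ⊕ s) ≡ s
  forwardDist-⊕ c {s} s<n = forwardDist-unique {x = c} s<n (sym (toℕ-fromℕ< (m%n<n (toℕ c + s) n)))

  forwardDist-⊕-back : ∀ (x : Fin n) {s t} → t < n → s + t ≡ n → forwardDist (x ⊕ s) x ≡ t
  forwardDist-⊕-back x {s} {t} t<n s+t≡n = forwardDist-unique {x = x ⊕ s} {y = x} t<n (begin
    (toℕ (x ⊕ s) + t) % n       ≡⟨ cong (λ z → (z + t) % n) (toℕ-fromℕ< (m%n<n (toℕ x + s) n)) ⟩
    ((toℕ x + s) % n + t) % n   ≡⟨ [m%n+o]%n≡[m+o]%n (toℕ x + s) t n ⟩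
    (toℕ x + s + t) % n         ≡⟨ cong (_% n) (+-assoc (toℕ x) s t) ⟩
    (toℕ x + (s + t)) % n       ≡⟨ cong (λ z → (toℕ x + z) % n) s+t≡n ⟩
    (toℕ x + n) % n             ≡⟨ [m+n]%n≡m%n (toℕ x) n ⟩
    toℕ x % n                   ≡⟨ m<n⇒m%n≡m (toℕ<n x) ⟩
    toℕ x                       ∎)
    where open ≡-Reasoning

  forwardDist-cocycle : (c x y : Fin n) → forwardDist x y ≡ (forwardDist c y + n ∸ forwardDist c x) % n
  forwardDist-cocycle c x y = forwardDist-unique {x = x} {y = y} (m%n<n (u + n ∸ s) n) (begin
    (toℕ x + (u + n ∸ s) % n) % n           ≡⟨ cong (λ z → (z + (u + n ∸ s) % n) % n) (forwardDist-correct c x) ⟨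
    ((toℕ c + s) % n + (u + n ∸ s) % n) % n ≡⟨ [m%n+o]%n≡[m+o]%n (toℕ c + s) _ n ⟩
    (toℕ c + s + (u + n ∸ s) % n) % n       ≡⟨ [m+n%o]%o≡[m+n]%o (toℕ c + s) (u + n ∸ s) n ⟩
    (toℕ c + s + (u + n ∸ s)) % n           ≡⟨ cong (_% n) (+-assoc (toℕ c) s (u + n ∸ s)) ⟩
    (toℕ c + (s + (u + n ∸ s))) % n         ≡⟨ cong (λ z → (toℕ c + z) % n) (m+[n∸m]≡n s≤u+n) ⟩
    (toℕ c + (u + n)) % n                   ≡⟨ cong (_% n) (+-assoc (toℕ c) u n) ⟨
    (toℕ c + u + n) % n                     ≡⟨ [m+n]%n≡m%n (toℕ c + u) n ⟩
    (toℕ c + u) % n                         ≡⟨ forwardDist-correct c y ⟩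
    toℕ y                                   ∎)
    where
    open ≡-Reasoning
    s = forwardDist c x
    u = forwardDist c y
    s≤u+n : s ≤ u + n
    s≤u+n = ≤-trans (<⇒≤ (forwardDist<n c x)) (m≤n+m n u)

  forwardDist-≤ : ∀ c {x y : Fin n} → forwardDist c x ≤ forwardDist c y →
                  forwardDist x y ≡ forwardDist c y ∸ forwardDist c x
  forwardDist-≤ c {x} {y} s≤u = trans (forwardDist-cocycle c x y) ([m+n∸o]%n≡m∸o s≤u (forwardDist<n c y))

  forwardDist-> : ∀ c {x y : Fin n} → forwardDist c y < forwardDist c x →
                  forwardDist x y ≡ forwardDist c y + n ∸ forwardDist c x
  forwardDist-> c {x} {y} u<s = trans (forwardDist-cocycle c x y) ([m+n∸o]%n≡m+n∸o u<s)

  stepEdge-true : ∀ {x y : Fin n} → 0 < forwardDist x y → forwardDist x y ≤ n / 4 → stepEdge x y ≡ true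
  stepEdge-true {x} {y} 0<d d≤k =
    cong₂ _∧_ (dec-true (1 ≤? forwardDist x y) 0<d) (dec-true (forwardDist x y ≤? n / 4) d≤k)

  stepEdge-false : ∀ {x y : Fin n} → n / 4 < forwardDist x y → stepEdge x y ≡ false
  stepEdge-false {x} {y} k<d =
    trans (cong ((1 ≤ᵇ forwardDist x y) ∧_) (dec-false (forwardDist x y ≤? n / 4) (<⇒≱ k<d))) (∧-zeroʳ _)

  stepEdge-within : ∀ c {x y : Fin n} → forwardDist c x < forwardDist c y →
                    forwardDist c y ≤ n / 4 + forwardDist c x → stepEdge x y ≡ true
  stepEdge-within c {x} {y} s<u u≤k+s = stepEdge-true {x = x} {y = y}
    (subst (0 <_) (sym d≡u∸s) (m<n⇒0<n∸m s<u))
    (subst (_≤ n / 4) (sym d≡u∸s)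
      (m≤n+o⇒m∸n≤o (forwardDist c y) (forwardDist c x) (subst (forwardDist c y ≤_) (+-comm (n / 4) _) u≤k+s)))
    where
    d≡u∸s : forwardDist x y ≡ forwardDist c y ∸ forwardDist c x
    d≡u∸s = forwardDist-≤ c (<⇒≤ s<u)

  adj-near : ∀ c {x y : Fin n} {s t} → forwardDist c x ≡ s → forwardDist c y ≡ t → s ≢ t →
             s ≤ n / 4 + t → t ≤ n / 4 + s → adj (circulantG p) x y ≡ true
  adj-near c {x} {y} refl refl s≢t s≤k+t t≤k+s with <-cmp (forwardDist c x) (forwardDist c y)
  ... | tri< s<t _ _ = cong (_∨ stepEdge y x) (stepEdge-within c s<t t≤k+s)
  ... | tri≈ _ s≡t _ = contradiction s≡t s≢t
  ... | tri> _ _ t<s = trans (cong (stepEdge x y ∨_) (stepEdge-within c t<s s≤k+t)) (∨-zeroʳ _)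

  adj-far : ∀ c {x y : Fin n} {s t} → forwardDist c x ≡ s → forwardDist c y ≡ t →
            n / 4 + s < t → n / 4 + t < s + n → adj (circulantG p) x y ≡ false
  adj-far c {x} {y} refl refl k+s<t k+t<s+n = cong₂ _∨_
    (stepEdge-false {x = x} {y = y}
      (subst (n / 4 <_) (sym (forwardDist-≤ c (<⇒≤ s<t))) (m+n≤o⇒m≤o∸n (suc (n / 4)) k+s<t)))
    (stepEdge-false {x = y} {y = x}
      (subst (n / 4 <_) (sym (forwardDist-> c s<t)) (m+n≤o⇒m≤o∸n (suc (n / 4)) k+t<s+n)))
    where
    s<t : forwardDist c x < forwardDist c y
    s<t = ≤-trans (s≤s (m≤n+m (forwardDist c x) (n / 4))) k+s<t
∣⁅x⁆∪⁅y⁆∣≡2 : ∀ {m} {x y : Fin m} → x ≢ y → ∣ ⁅ x ⁆ ∪ ⁅ y ⁆ ∣ ≡ 2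
∣⁅x⁆∪⁅y⁆∣≡2 {x = zero}  {zero}  x≢y = contradiction refl x≢y
∣⁅x⁆∪⁅y⁆∣≡2 {x = zero}  {suc y} _   = cong suc (trans (cong ∣_∣ (∪-identityˡ ⁅ y ⁆)) (∣⁅x⁆∣≡1 y))
∣⁅x⁆∪⁅y⁆∣≡2 {x = suc x} {zero}  _   = cong suc (trans (cong ∣_∣ (∪-identityʳ ⁅ x ⁆)) (∣⁅x⁆∣≡1 x))
∣⁅x⁆∪⁅y⁆∣≡2 {x = suc x} {suc y} x≢y = ∣⁅x⁆∪⁅y⁆∣≡2 (x≢y ∘ cong suc)

Complementary : ∀ {m} → Graph m → Fin m → Fin m → Set
Complementary G a b = ∀ y → y ≢ a → y ≢ b → adj G a y xor adj G b y ≡ true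

complementary⇒isolable : ∀ {m} (G : Graph m) {a b : Fin m} → 4 ≤ m → a ≢ b →
                         Complementary G a b → Isolable G (⁅ a ⁆ ∪ ⁅ b ⁆)
complementary⇒isolable {m} G {a} {b} 4≤m a≢b compl =
  ≤-reflexive (sym ∣W∣≡2) , subst (_≤ m ∸ 2) (sym ∣W∣≡2) (m+n≤o⇒m≤o∸n 2 4≤m) , U , separated
  where
  W : Subset m
  W = ⁅ a ⁆ ∪ ⁅ b ⁆

  ∣W∣≡2 : ∣ W ∣ ≡ 2
  ∣W∣≡2 = ∣⁅x⁆∪⁅y⁆∣≡2 a≢b

  -- Outside W the neighbourhood of a is the complement of that of b, so the edges between W
  -- and the rest toggled by this switching are exactly the existing ones.
  U : Subset m
  U = tabulate (λ z → does (z ≟ a) ∨ adj G b z)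

  U-a : lookup U a ≡ true
  U-a = trans (lookup∘tabulate _ a) (cong (_∨ adj G b a) (dec-true (a ≟ a) refl))

  U-b : lookup U b ≡ false
  U-b = trans (lookup∘tabulate _ b) (cong₂ _∨_ (dec-false (b ≟ a) (a≢b ∘ sym)) (irrefl G b))

  U-outside : ∀ y → y ≢ a → lookup U y ≡ adj G b y
  U-outside y y≢a = trans (lookup∘tabulate _ y) (cong (_∨ adj G b y) (dec-false (y ≟ a) y≢a))

  ∉W⇒≢a : ∀ {y} → y ∉ W → y ≢ a
  ∉W⇒≢a y∉W refl = y∉W (x∈p∪q⁺ (inj₁ (x∈⁅x⁆ a)))

  ∉W⇒≢b : ∀ {y} → y ∉ W → y ≢ b
  ∉W⇒≢b y∉W refl = y∉W (x∈p∪q⁺ (inj₂ (x∈⁅x⁆ b)))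

  separated : ∀ x y → x ∈ W → y ∉ W → switchAdj G U x y ≡ false
  separated x y x∈W y∉W with x∈p∪q⁻ ⁅ a ⁆ ⁅ b ⁆ x∈W
  ... | inj₁ x∈⁅a⁆ rewrite x∈⁅y⁆⇒x≡y a x∈⁅a⁆ | U-a | U-outside y (∉W⇒≢a y∉W) =
    trans (sym (not-distribʳ-xor (adj G a y) (adj G b y))) (cong not (compl y (∉W⇒≢a y∉W) (∉W⇒≢b y∉W)))
  ... | inj₂ x∈⁅b⁆ rewrite x∈⁅y⁆⇒x≡y b x∈⁅b⁆ | U-b | U-outside y (∉W⇒≢a y∉W) = xor-same (adj G b y)

deleteVertex-complementary : ∀ {m} (G : Graph (suc m)) {v a b : Fin (suc m)} (v≢a : v ≢ a) (v≢b : v ≢ b) →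
  (∀ y → y ≢ v → y ≢ a → y ≢ b → adj G a y xor adj G b y ≡ true) →
  Complementary (deleteVertex G v) (punchOut v≢a) (punchOut v≢b)
deleteVertex-complementary G {v} v≢a v≢b compl y y≢a y≢b =
  subst₂ (λ a b → adj G a (punchIn v y) xor adj G b (punchIn v y) ≡ true)
    (sym (punchIn-punchOut v≢a)) (sym (punchIn-punchOut v≢b))
    (compl (punchIn v y) (punchInᵢ≢i v y) (punchIn-≢ v≢a y≢a) (punchIn-≢ v≢b y≢b))
  where
  punchIn-≢ : ∀ {x} (v≢x : v ≢ x) → y ≢ punchOut v≢x → punchIn v y ≢ x
  punchIn-≢ v≢x y≢x′ e = y≢x′ (punchIn-injective v y _ (trans e (sym (punchIn-punchOut v≢x))))

deleteVertex-switchingSeparable : ∀ {m} (G : Graph (suc m)) {v a b : Fin (suc m)} → 4 ≤ m →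
  v ≢ a → v ≢ b → a ≢ b → (∀ y → y ≢ v → y ≢ a → y ≢ b → adj G a y xor adj G b y ≡ true) →
  SwitchingSeparable (deleteVertex G v)
deleteVertex-switchingSeparable G {v} 4≤m v≢a v≢b a≢b compl =
  _ , complementary⇒isolable (deleteVertex G v) 4≤m (a≢b ∘ punchOut-injective v≢a v≢b)
        (deleteVertex-complementary G v≢a v≢b compl)

odd-decomposition : ∀ p → suc p % 2 ≡ 1 →
  ∃ λ r → r ≤ 1 × p ≡ (r + suc p / 4 + suc p / 4) + (r + suc p / 4 + suc p / 4)
odd-decomposition p odd = by-residue (suc p % 4) (m%n<n (suc p) 4) (m≡m%n+[m/n]*n (suc p) 4)
  where
  k = suc p / 4

  residue-odd : ∀ ρ → suc p ≡ ρ + k * 4 → ρ % 2 ≡ 1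
  residue-odd ρ eq = begin
    ρ % 2                ≡⟨ [m+kn]%n≡m%n ρ (k * 2) 2 ⟨
    (ρ + k * 2 * 2) % 2  ≡⟨ cong (λ z → (ρ + z) % 2) (*-assoc k 2 2) ⟩
    (ρ + k * 4) % 2      ≡⟨ cong (_% 2) eq ⟨
    suc p % 2            ≡⟨ odd ⟩
    1                    ∎
    where open ≡-Reasoning

  4k≡[0+k+k]*2 : ∀ k → k * 4 ≡ (0 + k + k) + (0 + k + k)
  4k≡[0+k+k]*2 = solve-∀

  4k+2≡[1+k+k]*2 : ∀ k → 2 + k * 4 ≡ (1 + k + k) + (1 + k + k)
  4k+2≡[1+k+k]*2 = solve-∀

  by-residue : ∀ ρ → ρ < 4 → suc p ≡ ρ + k * 4 →
    ∃ λ r → r ≤ 1 × p ≡ (r + k + k) + (r + k + k)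
  by-residue 0 _ eq with () ← residue-odd 0 eq
  by-residue 1 _ eq = 0 , z≤n , trans (suc-injective eq) (4k≡[0+k+k]*2 k)
  by-residue 2 _ eq with () ← residue-odd 2 eq
  by-residue 3 _ eq = 1 , s≤s z≤n , trans (suc-injective eq) (4k+2≡[1+k+k]*2 k)
  by-residue (suc (suc (suc (suc _)))) (s≤s (s≤s (s≤s (s≤s ())))) _

window-dichotomy : ∀ {k r u} → r ≤ 1 → u ≢ r + k + k →
  (u ≤ k + k × u < (r + k) + (r + k)) ⊎ (k + k < u × (r + k) + (r + k) ≤ u)
window-dichotomy {k} {r} {u} r≤1 u≢w with u ≤? k + k | r≤1
... | yes u≤2k | z≤n     = inj₁ (u≤2k , ≤∧≢⇒< u≤2k u≢w)
... | yes u≤2k | s≤s z≤n = inj₁ (u≤2k , s≤s (≤-trans u≤2k (+-monoʳ-≤ k (n≤1+n k))))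
... | no  u≰2k | z≤n     = inj₂ (≰⇒> u≰2k , <⇒≤ (≰⇒> u≰2k))
... | no  u≰2k | s≤s z≤n =
  inj₂ (≰⇒> u≰2k , subst (_≤ u) (cong suc (sym (+-suc k k))) (≤∧≢⇒< (≰⇒> u≰2k) (u≢w ∘ sym)))

module SymmetricPair {p r : ℕ} (r≤1 : r ≤ 1)
            (p≡w+w : p ≡ (r + suc p / 4 + suc p / 4) + (r + suc p / 4 + suc p / 4))
            (0<k : 0 < suc p / 4) (v : Fin (suc p)) where

  private
    n k m w : ℕ
    n = suc p
    k = suc p / 4
    m = r + k
    w = m + k

  C : Graph n
  C = circulantG p

  -- Offsets are measured from c = v − w: b, v and a sit at k, w = m + k and k + 2m, and the
  -- closed neighbourhoods of b and a are the offset intervals [0, 2k] and [2m, n − 1].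

  c b a : Fin n
  c = v ⊕ suc w
  b = c ⊕ k
  a = c ⊕ (k + (m + m))

  k+[k+2m]≡p : k + (k + (m + m)) ≡ p
  k+[k+2m]≡p = trans (rearrange k m) (sym p≡w+w)
    where
    rearrange : ∀ k m → k + (k + (m + m)) ≡ (m + k) + (m + k)
    rearrange = solve-∀

  c→v : forwardDist c v ≡ w
  c→v = forwardDist-⊕-back v (subst (w <_) (cong suc (sym p≡w+w)) (s≤s (m≤m+n w w))) (cong suc (sym p≡w+w))

  c→b : forwardDist c b ≡ k
  c→b = forwardDist-⊕ c (s≤s (≤-trans (m≤m+n k _) (≤-reflexive k+[k+2m]≡p)))

  c→a : forwardDist c a ≡ k + (m + m)
  c→a = forwardDist-⊕ c (s≤s (≤-trans (m≤n+m _ k) (≤-reflexive k+[k+2m]≡p)))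

  0<m : 0 < m
  0<m = ≤-trans 0<k (m≤n+m k r)

  k<w : k < w
  k<w = m<n+m k 0<m

  w<k+2m : w < k + (m + m)
  w<k+2m = subst (_< k + (m + m)) (+-comm k m) (+-monoʳ-< k (m<m+n m 0<m))

  offset-≢⇒≢ : ∀ {x y s t} → forwardDist c x ≡ s → forwardDist c y ≡ t → s ≢ t → x ≢ y
  offset-≢⇒≢ refl refl s≢t x≡y = s≢t (cong (forwardDist c) x≡y)

  ≢⇒offset-≢ : ∀ {x y s} → forwardDist c x ≡ s → y ≢ x → forwardDist c y ≢ s
  ≢⇒offset-≢ refl y≢x u≡s = y≢x (forwardDist-injective c u≡s)

  v≢a : v ≢ a
  v≢a = offset-≢⇒≢ c→v c→a (<⇒≢ w<k+2m)

  v≢b : v ≢ b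
  v≢b = offset-≢⇒≢ c→v c→b (>⇒≢ k<w)

  a≢b : a ≢ b
  a≢b = offset-≢⇒≢ c→a c→b (>⇒≢ (<-trans k<w w<k+2m))

  complementary : ∀ y → y ≢ v → y ≢ a → y ≢ b → adj C a y xor adj C b y ≡ true
  complementary y y≢v y≢a y≢b
    with window-dichotomy {k} {r} r≤1 (≢⇒offset-≢ c→v y≢v)
  ... | inj₁ (u≤2k , u<2m) = cong₂ _xor_ a≁y b∼y
    where
    a≁y : adj C a y ≡ false
    a≁y = trans (Graph.sym C a y) (adj-far c refl c→a (+-monoʳ-< k u<2m)
            (≤-trans (s≤s (≤-reflexive k+[k+2m]≡p)) (m≤n+m n (forwardDist c y))))
    b∼y : adj C b y ≡ true
    b∼y = adj-near c c→b refl (≢⇒offset-≢ c→b y≢b ∘ sym) (m≤m+n k _) u≤2k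
  ... | inj₂ (2k<u , 2m≤u) = cong₂ _xor_ a∼y b≁y
    where
    a∼y : adj C a y ≡ true
    a∼y = adj-near c c→a refl (≢⇒offset-≢ c→a y≢a ∘ sym) (+-monoʳ-≤ k 2m≤u)
            (≤-trans (≤-pred (forwardDist<n c y)) (≤-reflexive (sym k+[k+2m]≡p)))
    b≁y : adj C b y ≡ false
    b≁y = adj-far c c→b refl 2k<u (+-monoʳ-< k (forwardDist<n c y))

proposition5 : (p : ℕ) → 5 ≤ suc p → suc p % 2 ≡ 1 →
    (v : Fin (suc p)) → SwitchingSeparable (deleteVertex (circulantG p) v)
proposition5 p 5≤n odd v with odd-decomposition p odd
... | r , r≤1 , p≡w+w = deleteVertex-switchingSeparable C (≤-pred 5≤n) v≢a v≢b a≢b complementary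
  where open SymmetricPair r≤1 p≡w+w (m≥n⇒m/n>0 (≤-trans (n≤1+n 4) 5≤n)) v
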